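{- Let $n\ge3$ be odd, let $f,B_0,C$ be nonzero integers with $B_0\neq-1$ squarefree and $\gcd(f,C)=1$, and put $B=f^2B_0$. Let $p$ be an odd prime with $p^r\|f$ for some $r>0$, and set $r'=\lceil 2r/n\rceil n-2r$. Then for every integer $t>0$: $\mathcal{Y}_{B,C}(\mathbb{Z};*_p^t)=\emptyset$ if $t>r$; $\mathcal{Y}_{B,C}(\mathbb{Z};*_p^t)=\emptyset$ if $0<t<r$ and $n\nmid t$; $\mathcal{Y}_{B,C}(\mathbb{Z};*_p^t)\cong\mathcal{Y}_{Bp^{ -2t},C}(\mathbb{Z};*_p^0,p\nmid y)$ if $0<t\le r$ and $n\mid t$; $\mathcal{Y}_{B,C}(\mathbb{Z};*_p^t)\cong\mathcal{Y}_{Bp^{ -2r},Cp^{r'}}(\mathbb{Z};*_p^0)$ if $t=r$ and $n\nmid t$.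
   Context: For nonzero integers $B',C'$, $\mathcal{Y}_{B',C'}(\mathbb{Z})$ is the groupoid of primitive integer solutions $[x:y:z]$ of $x^2+B'y^2=C'z^n$ (morphisms: $(x,y,z)\mapsto(-x,-y,z)$), and $\mathcal{Y}_{B',C'}(\mathbb{Z};\text{conditions})$ the full subgroupoid of objects satisfying the conditions. Writing $B'=f'^2B_0$ (here $f'=f/p^t$ resp. $f/p^r$, with the same squarefree $B_0$), put $u=x+f'\sqrt{ -B_0}\,y\in\mathcal{O}_K$, $K=\mathbb{Q}(\sqrt{ -B_0})$; condition $*_p^s$ means $u\in p^s\mathcal{O}_K\smallsetminus p^{s+1}\mathcal{O}_K$. $p^r\|f$ means $v_p(f)=r$. -}

module Defs where

open import Data.Nat as ℕ using (ℕ; zero; suc)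
import Data.Nat.DivMod as ℕD
open import Data.Nat.Divisibility as ℕDiv using ()
open import Data.Integer using (ℤ; +_; _+_; _*_; -_; ∣_∣; _^_; _%ℕ_)
open import Data.Product using (Σ; ∃; ∃₂; _×_; _,_; proj₁; proj₂)
open import Data.Sum using (_⊎_)
open import Relation.Nullary using (¬_)
open import Relation.Binary.PropositionalEquality using (_≡_)

Triple : Set
Triple = ℤ × ℤ × ℤ

neg : Triple → Triple
neg (x , y , z) = (- x , - y , z)

Primitive : Triple → Set
Primitive (x , y , z) =
  (d : ℕ) → d ℕDiv.∣ ∣ x ∣ → d ℕDiv.∣ ∣ y ∣ → d ℕDiv.∣ ∣ z ∣ → d ≡ 1

IsSol : ℕ → ℤ → ℤ → Triple → Set
IsSol n B' C' (x , y , z) = x * x + B' * (y * y) ≡ C' * (z ^ n)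

-- Membership  x + w √(-B0) ∈ m·O_K, K = ℚ(√(-B0)), B0 squarefree, B0 ≠ -1.
-- First argument is B0 mod 4.  O_K = ℤ[ω] with ω = (1 + √(-B0))/2 when
-- -B0 ≡ 1 (mod 4) (i.e. B0 ≡ 3 mod 4), and ω = √(-B0) otherwise.
-- m(a + bω) = m(a + b/2) + (m b/2) √(-B0) in the first case.
InIdealAux : ℕ → ℤ → ℤ → ℤ → Set
InIdealAux 3 m x w =
  ∃₂ λ a b → ((+ 2) * x ≡ m * ((+ 2) * a + b)) × ((+ 2) * w ≡ m * b)
InIdealAux _ m x w = ∃₂ λ a b → (x ≡ m * a) × (w ≡ m * b)

InIdeal : (B0 m x w : ℤ) → Set
InIdeal B0 m x w = InIdealAux (B0 %ℕ 4) m x w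

-- Condition *_p^s for (x,y,z), with B' = f'^2 B0 and u = x + f' √(-B0) y:
-- u ∈ p^s O_K \ p^(s+1) O_K.
Star : (B0 f' : ℤ) (p s : ℕ) → Triple → Set
Star B0 f' p s (x , y , z) =
  InIdeal B0 (+ (p ℕ.^ s)) x (f' * y) × ¬ InIdeal B0 (+ (p ℕ.^ suc s)) x (f' * y)

Obj : (n : ℕ) (B' C' : ℤ) (P : Triple → Set) → Set
Obj n B' C' P = Σ Triple λ t → IsSol n B' C' t × Primitive t × P t

Hom : (n : ℕ) (B' C' : ℤ) (P : Triple → Set) → Obj n B' C' P → Obj n B' C' P → Set
Hom n B' C' P a b = (proj₁ b ≡ proj₁ a) ⊎ (proj₁ b ≡ neg (proj₁ a))

-- Equivalence of groupoids: a functor (on objects F₀, on morphisms F₁)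
-- which is full and essentially surjective (faithfulness and the functor
-- laws are automatic since all hom-sets here are subsingletons).
record GEquiv (n₁ : ℕ) (B₁ C₁ : ℤ) (P₁ : Triple → Set)
              (n₂ : ℕ) (B₂ C₂ : ℤ) (P₂ : Triple → Set) : Set where
  field
    F₀   : Obj n₁ B₁ C₁ P₁ → Obj n₂ B₂ C₂ P₂
    F₁   : {a b : Obj n₁ B₁ C₁ P₁} →
           Hom n₁ B₁ C₁ P₁ a b → Hom n₂ B₂ C₂ P₂ (F₀ a) (F₀ b)
    full : {a b : Obj n₁ B₁ C₁ P₁} →
           Hom n₂ B₂ C₂ P₂ (F₀ a) (F₀ b) → Hom n₁ B₁ C₁ P₁ a b
    esso : (b : Obj n₂ B₂ C₂ P₂) →
           Σ (Obj n₁ B₁ C₁ P₁) λ a → Hom n₂ B₂ C₂ P₂ (F₀ a) b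

IsEmpty : (n : ℕ) (B' C' : ℤ) (P : Triple → Set) → Set
IsEmpty n B' C' P = ¬ Obj n B' C' P

ceilDiv : ℕ → ℕ → ℕ
ceilDiv a zero    = 0
ceilDiv a (suc k) = (a ℕ.+ k) ℕD./ suc k

Squarefree : ℤ → Set
Squarefree b = (d : ℕ) → (d ℕ.* d) ℕDiv.∣ ∣ b ∣ → d ≡ 1

-- For odd p the condition *_p^s says that p^s divides both x and f y but p^(s+1) does not divide
-- both.  If t > r this forces p ∣ y; then p ∣ x, p ∣ C zⁿ and p ∣ z, contradicting primitivity.
-- If t < r then p^(t+1) ∣ f y, so x = x₀ p^t with p ∤ x₀, and C zⁿ = (x₀² + p² B0 w²) p^(2t)
-- shows that p^(2t) exactly divides zⁿ; hence n ∣ 2t, and n ∣ t as n is odd.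
-- Otherwise p^(2t) ∣ zⁿ gives p^k ∣ z for k = ⌈2t/n⌉, and (x, y, z) ↦ (x / p^t, y, z / p^k),
-- which commutes with (x, y, z) ↦ (-x, -y, z), identifies the solutions with the primitive
-- solutions of x² + (f/p^t)² B0 y² = C p^(kn-2t) zⁿ having p ∤ y.  When n ∣ t the exponent
-- kn - 2t vanishes; when t = r and n ∤ r it is positive, and then p ∤ y is automatic.
module Submission where

open import Defs
open import Data.Nat as ℕ using (ℕ; zero; suc; _<_; _≤_; _∸_; z≤n; s≤s)
import Data.Nat.Properties as ℕ
open import Data.Nat.Divisibility as ℕDiv using ()
open import Data.Nat.Coprimality as Coprimality using (Coprime; coprime-divisor)
open import Data.Nat.Primality
  using (Prime; prime[2]; euclidsLemma; prime⇒irreducible; prime⇒nonTrivial; prime⇒nonZero)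
open import Data.Product using (Σ; ∃₂; _×_; _,_; proj₁; proj₂)
open import Data.Sum using (inj₁; inj₂; [_,_]′)
open import Function using (id; _∘_)
open import Relation.Nullary using (¬_; yes; no; contradiction)
open import Relation.Binary.PropositionalEquality

module PrimePowers where

  open import Data.Nat.Base
  open import Data.Nat.Properties
  open import Data.Nat.DivMod using (_%_; m≡m%n+[m/n]*n; m%n<n; m/n*n≤m)
  open import Data.Nat.Divisibility

  private variable
    d e k m n : ℕ

  ^-distribʳ-* : ∀ m n k → (m * n) ^ k ≡ m ^ k * n ^ k
  ^-distribʳ-* m n zero    = refl
  ^-distribʳ-* m n (suc k) = trans (cong (m * n *_) (^-distribʳ-* m n k))
                                   ([m*n]*[o*p]≡[m*o]*[n*p] m n (m ^ k) (n ^ k))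

  m^n*m^n≡m^[2*n] : ∀ m n → m ^ n * m ^ n ≡ m ^ (2 * n)
  m^n*m^n≡m^[2*n] m n =
    trans (sym (^-distribˡ-+-* m n n)) (cong (λ j → m ^ (n + j)) (sym (+-identityʳ n)))

  m∣m^n : 0 < n → m ∣ m ^ n
  m∣m^n {n = suc n} {m = m} _ = m∣m*n (m ^ n)

  ^-monoʳ-∣ : ∀ m → d ≤ e → m ^ d ∣ m ^ e
  ^-monoʳ-∣ {d = d} {e = e} m d≤e = divides (m ^ (e ∸ d))
    (trans (cong (m ^_) (sym (m∸n+n≡m d≤e))) (^-distribˡ-+-* m (e ∸ d) d))

  ^-monoˡ-∣ : ∀ k → d ∣ m → d ^ k ∣ m ^ k
  ^-monoˡ-∣ zero    _   = ∣-refl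
  ^-monoˡ-∣ (suc k) d∣m = *-pres-∣ d∣m (^-monoˡ-∣ k d∣m)

  ^∸-cancelʳ-∣ : ∀ m .{{_ : NonZero m}} e k → m ^ e ∣ n * m ^ k → m ^ (e ∸ k) ∣ n
  ^∸-cancelʳ-∣ {n = n} m e k m^e∣n*m^k with k ≤? e
  ... | yes k≤e = *-cancelʳ-∣ (m ^ k) {{m^n≢0 m k}} (subst (_∣ n * m ^ k) m^e≡ m^e∣n*m^k)
    where
    m^e≡ : m ^ e ≡ m ^ (e ∸ k) * m ^ k
    m^e≡ = trans (cong (m ^_) (sym (m∸n+n≡m k≤e))) (^-distribˡ-+-* m (e ∸ k) k)
  ... | no k≰e = subst (λ j → m ^ j ∣ n) (sym (m≤n⇒m∸n≡0 (≰⇒≥ k≰e))) (1∣ n)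

  coprime-∣ˡ : Coprime m n → d ∣ m → Coprime d n
  coprime-∣ˡ m⊥n d∣m (i∣d , i∣n) = m⊥n (∣-trans i∣d d∣m , i∣n)

  coprime-^ʳ : Coprime m n → ∀ e → Coprime m (n ^ e)
  coprime-^ʳ _   zero    (_ , i∣1)       = ∣1⇒≡1 i∣1
  coprime-^ʳ m⊥n (suc e) (i∣m , i∣n*n^e) =
    coprime-^ʳ m⊥n e (i∣m , coprime-divisor (coprime-∣ˡ m⊥n i∣m) i∣n*n^e)

  m≤ceilDiv[m,n]*n : ∀ m n → m ≤ ceilDiv m (suc n) * suc n
  m≤ceilDiv[m,n]*n m n = +-cancelʳ-≤ n m _ (begin
    m + n                                        ≡⟨ m≡m%n+[m/n]*n (m + n) (suc n) ⟩
    (m + n) % suc n + ceilDiv m (suc n) * suc n  ≤⟨ +-monoˡ-≤ _ (≤-pred (m%n<n (m + n) (suc n))) ⟩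
    n + ceilDiv m (suc n) * suc n                ≡⟨ +-comm n _ ⟩
    ceilDiv m (suc n) * suc n + n                ∎)
    where open ≤-Reasoning

  ceilDiv[m,n]*n<n+m : ∀ m n → ceilDiv m (suc n) * suc n < suc n + m
  ceilDiv[m,n]*n<n+m m n = s≤s (≤-trans (m/n*n≤m (m + n) (suc n)) (≤-reflexive (+-comm m n)))

  module _ {p : ℕ} (prime : Prime p) where

    private instance
      p≢0 : NonZero p
      p≢0 = prime⇒nonZero prime

    prime≢1 : p ≢ 1
    prime≢1 = nonTrivial⇒≢1 {{prime⇒nonTrivial prime}}

    prime∤⇒coprime : ¬ p ∣ m → Coprime m p
    prime∤⇒coprime p∤m (i∣m , i∣p) with prime⇒irreducible prime i∣p
    ... | inj₁ i≡1  = i≡1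
    ... | inj₂ refl = contradiction i∣m p∤m

    prime∣^⇒∣ : ∀ m k → p ∣ m ^ k → p ∣ m
    prime∣^⇒∣ m zero    p∣1     = contradiction (∣1⇒≡1 p∣1) prime≢1
    prime∣^⇒∣ m (suc k) p∣m*m^k = [ id , prime∣^⇒∣ m k ]′ (euclidsLemma m (m ^ k) prime p∣m*m^k)

    -- The bound k * n < n + e says k ≤ ⌈e/n⌉.
    prime^∣^⇒^∣ : ∀ n k e → k * n < n + e → p ^ e ∣ m ^ n → p ^ k ∣ m
    prime^∣^⇒^∣ n zero    e       _  _ = 1∣ _
    prime^∣^⇒^∣ n (suc k) zero    lt _ = contradiction (+-cancelˡ-< n (k * n) 0 lt) n≮0
    prime^∣^⇒^∣ {m} n (suc k) (suc e) lt p^e∣m^n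
      with prime∣^⇒∣ m n (∣-trans (m∣m*n (p ^ e)) p^e∣m^n)
    ... | divides w refl = subst (_∣ w * p) (*-comm (p ^ k) p) (*-monoˡ-∣ p p^k∣w)
      where
      p^k∣w : p ^ k ∣ w
      p^k∣w = prime^∣^⇒^∣ n k (suc e ∸ n)
        (<-≤-trans (+-cancelˡ-< n (k * n) (suc e) lt) (m≤n+m∸n (suc e) n))
        (^∸-cancelʳ-∣ p (suc e) n (subst (p ^ suc e ∣_) (^-distribʳ-* w p n) p^e∣m^n))

    ^∥^⇒∣ : ∀ n e → p ^ e ∣ m ^ suc n → ¬ p ^ suc e ∣ m ^ suc n → suc n ∣ e
    ^∥^⇒∣ {m = m} n e p^e∣m^n p^1+e∤m^n = divides ⌈e/n⌉ (sym ⌈e/n⌉*n≡e)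
      where
      ⌈e/n⌉ : ℕ
      ⌈e/n⌉ = ceilDiv e (suc n)
      p^⌈e/n⌉n∣m^n : p ^ (⌈e/n⌉ * suc n) ∣ m ^ suc n
      p^⌈e/n⌉n∣m^n = subst (_∣ m ^ suc n) (^-*-assoc p ⌈e/n⌉ (suc n)) (^-monoˡ-∣ (suc n)
        (prime^∣^⇒^∣ {m = m} (suc n) ⌈e/n⌉ e (ceilDiv[m,n]*n<n+m e n) p^e∣m^n))
      ⌈e/n⌉*n≡e : ⌈e/n⌉ * suc n ≡ e
      ⌈e/n⌉*n≡e = ≤-antisym
        (≮⇒≥ (λ e<⌈e/n⌉n → p^1+e∤m^n (∣-trans (^-monoʳ-∣ p e<⌈e/n⌉n) p^⌈e/n⌉n∣m^n)))
        (m≤ceilDiv[m,n]*n e n)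

    c*m^n≡s*p^e⇒p^e∣m^n : ∀ {c m n s e} → ¬ p ∣ c → c * m ^ n ≡ s * p ^ e → p ^ e ∣ m ^ n
    c*m^n≡s*p^e⇒p^e∣m^n {s = s} {e} p∤c eq =
      coprime-divisor (Coprimality.sym (coprime-^ʳ (prime∤⇒coprime p∤c) e)) (divides s eq)

    c*m^n≡s*p^e⇒p^k∣m : ∀ {c m n s e} k →
      ¬ p ∣ c → c * m ^ n ≡ s * p ^ e → k * n < n + e → p ^ k ∣ m
    c*m^n≡s*p^e⇒p^k∣m {c} {m} {n} {s} {e} k p∤c eq lt =
      prime^∣^⇒^∣ n k e lt (c*m^n≡s*p^e⇒p^e∣m^n {c} {m} {n} {s} {e} p∤c eq)

    c*m^n≡s*p^e⇒n∣e : ∀ {c m n s e} →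
      ¬ p ∣ c → ¬ p ∣ s → c * m ^ suc n ≡ s * p ^ e → suc n ∣ e
    c*m^n≡s*p^e⇒n∣e {c} {m} {n} {s} {e} p∤c p∤s eq =
      ^∥^⇒∣ {m = m} n e (c*m^n≡s*p^e⇒p^e∣m^n {c} {m} {suc n} {s} {e} p∤c eq) p^1+e∤m^n
      where
      p^1+e∤m^n : ¬ p ^ suc e ∣ m ^ suc n
      p^1+e∤m^n p^1+e∣m^n = p∤s (*-cancelʳ-∣ (p ^ e) {{m^n≢0 p e}}
        (subst (p * p ^ e ∣_) eq (∣n⇒∣m*n c p^1+e∣m^n)))

  odd-^ : ¬ 2 ∣ m → ¬ 2 ∣ m ^ k
  odd-^ {m = m} {k = k} 2∤m 2∣m^k = 2∤m (prime∣^⇒∣ prime[2] m k 2∣m^k)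

  odd-∣-double : ¬ 2 ∣ n → n ∣ 2 * m → n ∣ m
  odd-∣-double 2∤n = coprime-divisor (prime∤⇒coprime prime[2] 2∤n)

  prime≢2⇒odd : ∀ {p} → Prime p → p ≢ 2 → ¬ 2 ∣ p
  prime≢2⇒odd p-prime p≢2 2∣p = [ (λ ()) , p≢2 ∘ sym ]′ (prime⇒irreducible p-prime 2∣p)

open PrimePowers

open import Data.Integer as ℤ using (ℤ; +_; -_; _+_; _-_; _*_; _^_; ∣_∣; NonZero)
import Data.Integer.Properties as ℤ
open import Data.Integer.Divisibility using (_∣_)
import Data.Integer.Divisibility.Signed as Signed
import Data.Integer.Coprimality as ℤCoprimality
open import Data.Integer.Tactic.RingSolver using (solve-∀)
open import Data.Product.Function.NonDependent.Propositional using (_×-⇔_)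
open import Function.Bundles using (_⇔_; mk⇔; module Equivalence)
open import Function.Related.Propositional as Related using (SK-sym)
open import Function.Related.TypeIsomorphisms using (¬-cong-⇔)
open Equivalence using (to; from)

^-distribʳ-*ᶻ : ∀ i j n → (i * j) ^ n ≡ i ^ n * j ^ n
^-distribʳ-*ᶻ i j zero    = refl
^-distribʳ-*ᶻ i j (suc n) =
  trans (cong (i * j *_) (^-distribʳ-*ᶻ i j n)) (interchange i j (i ^ n) (j ^ n))
  where
  interchange : ∀ a b c d → a * b * (c * d) ≡ a * c * (b * d)
  interchange = solve-∀

pos-^ : ∀ m n → + (m ℕ.^ n) ≡ (+ m) ^ n
pos-^ m zero    = refl
pos-^ m (suc n) = trans (ℤ.pos-* m (m ℕ.^ n)) (cong (+ m *_) (pos-^ m n))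

abs-^ : ∀ i n → ∣ i ^ n ∣ ≡ ∣ i ∣ ℕ.^ n
abs-^ i zero    = refl
abs-^ i (suc n) = trans (ℤ.abs-* i (i ^ n)) (cong (∣ i ∣ ℕ.*_) (abs-^ i n))

abs-*^ : ∀ i j n → ∣ i * j ^ n ∣ ≡ ∣ i ∣ ℕ.* ∣ j ∣ ℕ.^ n
abs-*^ i j n = trans (ℤ.abs-* i (j ^ n)) (cong (∣ i ∣ ℕ.*_) (abs-^ j n))

∣m⇒∣m*n : ∀ {k i} j → k ∣ i → k ∣ i * j
∣m⇒∣m*n {k} {i} j k∣i = subst (∣ k ∣ ℕDiv.∣_) (sym (ℤ.abs-* i j)) (ℕDiv.∣m⇒∣m*n ∣ j ∣ k∣i)

∣n⇒∣m*n : ∀ {k j} i → k ∣ j → k ∣ i * j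
∣n⇒∣m*n {k} {j} i k∣j = subst (∣ k ∣ ℕDiv.∣_) (sym (ℤ.abs-* i j)) (ℕDiv.∣n⇒∣m*n ∣ i ∣ k∣j)

∣-sumOfSquares : ∀ {k x y} B → k ∣ x → k ∣ y → k ∣ x * x + B * (y * y)
∣-sumOfSquares {k} {x} {y} B k∣x k∣y = Signed.∣⇒∣ᵤ (Signed.∣m∣n⇒∣m+n
  (Signed.∣m⇒∣m*n x (Signed.∣ᵤ⇒∣ {k} {x} k∣x))
  (Signed.∣n⇒∣m*n B (Signed.∣m⇒∣m*n y (Signed.∣ᵤ⇒∣ {k} {y} k∣y))))

∣-square⇒∣ : ∀ {p} → Prime p → ∀ {x} → + p ∣ x * x → + p ∣ x
∣-square⇒∣ p-prime {x} p∣x*x =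
  [ id , id ]′ (euclidsLemma ∣ x ∣ ∣ x ∣ p-prime (subst (_ ℕDiv.∣_) (ℤ.abs-* x x) p∣x*x))

multiple⇒∣ : ∀ k a {i} → i ≡ k * a → k ∣ i
multiple⇒∣ k a refl = subst (∣ k ∣ ℕDiv.∣_) (sym (ℤ.abs-* k a)) (ℕDiv.m∣m*n ∣ a ∣)

∣⇒multiple : ∀ k i → k ∣ i → Σ ℤ λ a → i ≡ k * a
∣⇒multiple k i k∣i with Signed.∣ᵤ⇒∣ {k} {i} k∣i
... | Signed.divides a i≡ak = a , trans i≡ak (ℤ.*-comm a k)

∣-*ʳ⇔ : ∀ {m k i} .{{_ : ℕ.NonZero k}} → (+ m ∣ i) ⇔ (+ (m ℕ.* k) ∣ i * + k)
∣-*ʳ⇔ {m} {k} {i} = mk⇔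
  (λ m∣i → subst (m ℕ.* k ℕDiv.∣_) (sym (ℤ.abs-* i (+ k))) (ℕDiv.*-monoˡ-∣ k m∣i))
  (λ mk∣ik → ℕDiv.*-cancelʳ-∣ k (subst (m ℕ.* k ℕDiv.∣_) (ℤ.abs-* i (+ k)) mk∣ik))

infix 4 _∣²_ _∥[_]_

_∣²_ : ℕ → ℤ × ℤ → Set
m ∣² (x , w) = (+ m ∣ x) × (+ m ∣ w)

-- For odd p, p ∥[ s ] (x , w) is the condition *_p^s on u = x + w √-B0.
_∥[_]_ : ℕ → ℕ → ℤ × ℤ → Set
p ∥[ s ] u = p ℕ.^ s ∣² u × ¬ p ℕ.^ suc s ∣² u

module _ {m : ℕ} {x w : ℤ} where

  multiples⇔∣² : (∃₂ λ a b → x ≡ + m * a × w ≡ + m * b) ⇔ m ∣² (x , w)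
  multiples⇔∣² = mk⇔
    (λ (a , b , x≡ma , w≡mb) → multiple⇒∣ (+ m) a x≡ma , multiple⇒∣ (+ m) b w≡mb)
    (λ (m∣x , m∣w) → let (a , x≡ma) = ∣⇒multiple (+ m) x m∣x
                         (b , w≡mb) = ∣⇒multiple (+ m) w m∣w
                     in a , b , x≡ma , w≡mb)

  -- The half-integral basis element (1 + √-B0)/2 of O_K is invisible to odd m.
  halfMultiples⇔∣² : ¬ 2 ℕDiv.∣ m →
    (∃₂ λ a b → + 2 * x ≡ + m * (+ 2 * a + b) × + 2 * w ≡ + m * b) ⇔ m ∣² (x , w)
  halfMultiples⇔∣² 2∤m = mk⇔
    (λ (a , b , 2x≡m[2a+b] , 2w≡mb) → halve x (multiple⇒∣ (+ m) (+ 2 * a + b) 2x≡m[2a+b]) ,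
                                        halve w (multiple⇒∣ (+ m) b 2w≡mb))
    (λ (m∣x , m∣w) → let (a , x≡ma) = ∣⇒multiple (+ m) x m∣x
                         (b , w≡mb) = ∣⇒multiple (+ m) w m∣w
                     in a - b , + 2 * b ,
                        trans (cong (+ 2 *_) x≡ma) (2ma≡m[2[a-b]+2b] (+ m) a b) ,
                        trans (cong (+ 2 *_) w≡mb) (2mb≡m[2b] (+ m) b))
    where
    halve : ∀ i → + m ∣ + 2 * i → + m ∣ i
    halve i = ℤCoprimality.coprime-divisor (+ m) (+ 2) i (prime∤⇒coprime prime[2] 2∤m)
    2ma≡m[2[a-b]+2b] : ∀ m a b → + 2 * (m * a) ≡ m * (+ 2 * (a - b) + + 2 * b)
    2ma≡m[2[a-b]+2b] = solve-∀
    2mb≡m[2b] : ∀ m b → + 2 * (m * b) ≡ m * (+ 2 * b)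
    2mb≡m[2b] = solve-∀

  inIdealAux⇔∣² : ∀ k → ¬ 2 ℕDiv.∣ m → InIdealAux k (+ m) x w ⇔ m ∣² (x , w)
  inIdealAux⇔∣² 0                         _   = multiples⇔∣²
  inIdealAux⇔∣² 1                         _   = multiples⇔∣²
  inIdealAux⇔∣² 2                         _   = multiples⇔∣²
  inIdealAux⇔∣² 3                         2∤m = halfMultiples⇔∣² 2∤m
  inIdealAux⇔∣² (suc (suc (suc (suc _)))) _   = multiples⇔∣²

star⇔∥ : ∀ {B0 f p s x y z} → ¬ 2 ℕDiv.∣ p → Star B0 f p s (x , y , z) ⇔ p ∥[ s ] (x , f * y)
star⇔∥ {B0} {s = s} 2∤p = inIdealAux⇔∣² (B0 ℤ.%ℕ 4) (odd-^ {k = s} 2∤p)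
                    ×-⇔ ¬-cong-⇔ (inIdealAux⇔∣² (B0 ℤ.%ℕ 4) (odd-^ {k = suc s} 2∤p))

∥-scale : ∀ {p s t x w} .{{_ : ℕ.NonZero p}} →
  p ∥[ s ] (x , w) ⇔ p ∥[ s ℕ.+ t ] (x * + (p ℕ.^ t) , w * + (p ℕ.^ t))
∥-scale {p} {s} {t} {x} {w} = scale s ×-⇔ ¬-cong-⇔ (scale (suc s))
  where
  instance
    p^t≢0 : ℕ.NonZero (p ℕ.^ t)
    p^t≢0 = ℕ.m^n≢0 p t
  P : ℤ
  P = + (p ℕ.^ t)
  scale : ∀ j → p ℕ.^ j ∣² (x , w) ⇔ p ℕ.^ (j ℕ.+ t) ∣² (x * P , w * P)
  scale j = subst (λ e → p ℕ.^ j ∣² (x , w) ⇔ e ∣² (x * P , w * P))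
    (sym (ℕ.^-distribˡ-+-* p j t))
    (∣-*ʳ⇔ {p ℕ.^ j} {p ℕ.^ t} {x} ×-⇔ ∣-*ʳ⇔ {p ℕ.^ j} {p ℕ.^ t} {w})

star-rescale : ∀ {B0 f' p t x y z z′} .{{_ : ℕ.NonZero p}} → ¬ 2 ℕDiv.∣ p →
  Star B0 (+ (p ℕ.^ t) * f') p t (x * + (p ℕ.^ t) , y , z) ⇔ Star B0 f' p 0 (x , y , z′)
star-rescale {B0} {f'} {p} {t} {x} {y} {z} {z′} 2∤p = begin
  Star B0 (P * f') p t (x * P , y , z)  ∼⟨ star⇔∥ {B0} {P * f'} {p} {t} {x * P} {y} {z} 2∤p ⟩
  p ∥[ t ] (x * P , P * f' * y)         ≡⟨ cong (λ w → p ∥[ t ] (x * P , w)) Pf'y≡f'yP ⟩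
  p ∥[ t ] (x * P , f' * y * P)         ∼⟨ SK-sym (∥-scale {p} {0} {t} {x} {f' * y}) ⟩
  p ∥[ 0 ] (x , f' * y)                 ∼⟨ SK-sym (star⇔∥ {B0} {f'} {p} {0} {x} {y} {z′} 2∤p) ⟩
  Star B0 f' p 0 (x , y , z′)           ∎
  where
  open Related.EquationalReasoning
  P : ℤ
  P = + (p ℕ.^ t)
  Pf'y≡f'yP : P * f' * y ≡ f' * y * P
  Pf'y≡f'yP = trans (ℤ.*-assoc P f' y) (ℤ.*-comm P (f' * y))

IsObj : ℕ → ℤ → ℤ → (Triple → Set) → Triple → Set
IsObj n B C P t = IsSol n B C t × Primitive t × P t

StarCoprimeY : ℤ → ℤ → ℕ → Triple → Set
StarCoprimeY B0 f p (x , y , z) = Star B0 f p 0 (x , y , z) × ¬ (+ p ∣ y)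

module _ {n₁ n₂ : ℕ} {B₁ C₁ B₂ C₂ : ℤ} {P₁ P₂ : Triple → Set} (g : Triple → Triple)
         (g-injective : ∀ {s t} → g s ≡ g t → s ≡ t) (g-neg : ∀ t → g (neg t) ≡ neg (g t)) where

  GEquiv-viaInjection :
    ((b : Obj n₂ B₂ C₂ P₂) → IsObj n₁ B₁ C₁ P₁ (g (proj₁ b))) →
    ((a : Obj n₁ B₁ C₁ P₁) → Σ (Obj n₂ B₂ C₂ P₂) λ b → g (proj₁ b) ≡ proj₁ a) →
    GEquiv n₁ B₁ C₁ P₁ n₂ B₂ C₂ P₂
  GEquiv-viaInjection lift descend = record
    { F₀ = F₀ ; F₁ = λ {a} {b} → F₁ {a} {b} ; full = λ {a} {b} → full {a} {b} ; esso = esso }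
    where
    open ≡-Reasoning
    F₀ : Obj n₁ B₁ C₁ P₁ → Obj n₂ B₂ C₂ P₂
    F₀ = proj₁ ∘ descend
    g-F₀ : ∀ a → g (proj₁ (F₀ a)) ≡ proj₁ a
    g-F₀ = proj₂ ∘ descend
    F₁ : ∀ {a b} → Hom n₁ B₁ C₁ P₁ a b → Hom n₂ B₂ C₂ P₂ (F₀ a) (F₀ b)
    F₁ {a} {b} (inj₁ b≡a) = inj₁ (g-injective (begin
      g (proj₁ (F₀ b))       ≡⟨ g-F₀ b ⟩
      proj₁ b                ≡⟨ b≡a ⟩
      proj₁ a                ≡⟨ g-F₀ a ⟨
      g (proj₁ (F₀ a))       ∎))
    F₁ {a} {b} (inj₂ b≡-a) = inj₂ (g-injective (begin
      g (proj₁ (F₀ b))       ≡⟨ g-F₀ b ⟩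
      proj₁ b                ≡⟨ b≡-a ⟩
      neg (proj₁ a)          ≡⟨ cong neg (g-F₀ a) ⟨
      neg (g (proj₁ (F₀ a))) ≡⟨ g-neg (proj₁ (F₀ a)) ⟨
      g (neg (proj₁ (F₀ a))) ∎))
    full : ∀ {a b} → Hom n₂ B₂ C₂ P₂ (F₀ a) (F₀ b) → Hom n₁ B₁ C₁ P₁ a b
    full {a} {b} (inj₁ b≡a) = inj₁ (begin
      proj₁ b                ≡⟨ g-F₀ b ⟨
      g (proj₁ (F₀ b))       ≡⟨ cong g b≡a ⟩
      g (proj₁ (F₀ a))       ≡⟨ g-F₀ a ⟩
      proj₁ a                ∎)
    full {a} {b} (inj₂ b≡-a) = inj₂ (begin
      proj₁ b                ≡⟨ g-F₀ b ⟨
      g (proj₁ (F₀ b))       ≡⟨ cong g b≡-a ⟩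
      g (neg (proj₁ (F₀ a))) ≡⟨ g-neg (proj₁ (F₀ a)) ⟩
      neg (g (proj₁ (F₀ a))) ≡⟨ cong neg (g-F₀ a) ⟩
      neg (proj₁ a)          ∎)
    esso : (b : Obj n₂ B₂ C₂ P₂) → Σ (Obj n₁ B₁ C₁ P₁) λ a → Hom n₂ B₂ C₂ P₂ (F₀ a) b
    esso b = a , inj₁ (sym (g-injective (g-F₀ a)))
      where
      a : Obj n₁ B₁ C₁ P₁
      a = g (proj₁ b) , lift b

GEquiv-congʳ : ∀ {n₁ n₂ B₁ C₁ B₂ C₂} {P₁ P Q : Triple → Set} →
  (∀ {t} → IsSol n₂ B₂ C₂ t → P t → Q t) → (∀ {t} → IsSol n₂ B₂ C₂ t → Q t → P t) →
  GEquiv n₁ B₁ C₁ P₁ n₂ B₂ C₂ P → GEquiv n₁ B₁ C₁ P₁ n₂ B₂ C₂ Q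
GEquiv-congʳ {n₂ = n₂} {B₂ = B₂} {C₂ = C₂} P⇒Q Q⇒P e = record
  { F₀   = convert P⇒Q ∘ F₀
  ; F₁   = λ {a} {b} → F₁ {a} {b}
  ; full = λ {a} {b} → full {a} {b}
  ; esso = esso ∘ convert Q⇒P
  }
  where
  open GEquiv e
  convert : ∀ {R S : Triple → Set} → (∀ {t} → IsSol n₂ B₂ C₂ t → R t → S t) →
            Obj n₂ B₂ C₂ R → Obj n₂ B₂ C₂ S
  convert R⇒S (t , sol , prim , r) = t , sol , prim , R⇒S sol r

scale : ℤ → ℤ → Triple → Triple
scale P Q (x , y , z) = x * P , y , z * Q

scale-injective : ∀ P Q .{{_ : NonZero P}} .{{_ : NonZero Q}} {s t} →
  scale P Q s ≡ scale P Q t → s ≡ t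
scale-injective P Q {x , y , z} {x′ , y′ , z′} eq =
  cong₂ _,_ (ℤ.*-cancelʳ-≡ x x′ P (cong proj₁ eq))
            (cong₂ _,_ (cong (proj₁ ∘ proj₂) eq) (ℤ.*-cancelʳ-≡ z z′ Q (cong (proj₂ ∘ proj₂) eq)))

scale-neg : ∀ P Q t → scale P Q (neg t) ≡ neg (scale P Q t)
scale-neg P Q (x , y , z) = cong (_, - y , z * Q) (sym (ℤ.neg-distribˡ-* x P))

primitive-descale : ∀ {x y z} P Q → Primitive (x * P , y , z * Q) → Primitive (x , y , z)
primitive-descale {x} {y} {z} P Q prim d d∣x d∣y d∣z =
  prim d (∣m⇒∣m*n {+ d} {x} P d∣x) d∣y (∣m⇒∣m*n {+ d} {z} Q d∣z)

primitive-rescale : ∀ {x y z} P Q → Coprime ∣ y ∣ ∣ P ∣ → Coprime ∣ y ∣ ∣ Q ∣ →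
  Primitive (x , y , z) → Primitive (x * P , y , z * Q)
primitive-rescale {x} {y} {z} P Q y⊥P y⊥Q prim d d∣xP d∣y d∣zQ =
  prim d (cancel x P y⊥P d∣xP) d∣y (cancel z Q y⊥Q d∣zQ)
  where
  cancel : ∀ i k → Coprime ∣ y ∣ ∣ k ∣ → d ℕDiv.∣ ∣ i * k ∣ → d ℕDiv.∣ ∣ i ∣
  cancel i k y⊥k d∣ik = coprime-divisor (coprime-∣ˡ y⊥k d∣y)
    (subst (d ℕDiv.∣_) (trans (ℤ.abs-* i k) (ℕ.*-comm ∣ i ∣ ∣ k ∣)) d∣ik)

rescale-identity : ∀ x y P f' B0 → x * P * (x * P) + P * f' * (P * f') * B0 * (y * y)
                                   ≡ (x * x + f' * f' * B0 * (y * y)) * (P * P)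
rescale-identity = solve-∀

isSol-factor : ∀ {n f f' B0 C} P x y z → f ≡ P * f' → IsSol n (f * f * B0) C (x * P , y , z) →
  C * z ^ n ≡ (x * x + f' * f' * B0 * (y * y)) * (P * P)
isSol-factor {f' = f'} {B0} P x y z refl sol = trans (sym sol) (rescale-identity x y P f' B0)

isSol-rescale : ∀ {n f f' B0 C C'} P Q .{{_ : NonZero P}} {x y z} →
  f ≡ P * f' → C' * (P * P) ≡ C * Q ^ n →
  IsSol n (f * f * B0) C (x * P , y , z * Q) ⇔ IsSol n (f' * f' * B0) C' (x , y , z)
isSol-rescale {n} {f' = f'} {B0} {C} {C'} P Q {x} {y} {z} refl C'P²≡CQⁿ = mk⇔
  (λ sol → ℤ.*-cancelʳ-≡ _ _ (P * P) {{ℤ.i*j≢0 P P}}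
     (trans (sym (isSol-factor {n} {P * f'} {f'} {B0} {C} P x y (z * Q) refl sol)) C[zQ]ⁿ≡C'zⁿP²))
  (λ sol → trans (rescale-identity x y P f' B0)
                 (trans (cong (_* (P * P)) sol) (sym C[zQ]ⁿ≡C'zⁿP²)))
  where
  open ≡-Reasoning
  swap : ∀ a b c → a * (b * c) ≡ b * (a * c)
  swap = solve-∀
  swap′ : ∀ a b c → a * (b * c) ≡ b * a * c
  swap′ = solve-∀
  C[zQ]ⁿ≡C'zⁿP² : C * (z * Q) ^ n ≡ C' * z ^ n * (P * P)
  C[zQ]ⁿ≡C'zⁿP² = begin
    C * (z * Q) ^ n        ≡⟨ cong (C *_) (^-distribʳ-*ᶻ z Q n) ⟩
    C * (z ^ n * Q ^ n)    ≡⟨ swap C (z ^ n) (Q ^ n) ⟩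
    z ^ n * (C * Q ^ n)    ≡⟨ cong (z ^ n *_) C'P²≡CQⁿ ⟨
    z ^ n * (C' * (P * P)) ≡⟨ swap′ (z ^ n) C' (P * P) ⟩
    C' * z ^ n * (P * P)   ∎

-- With q = p and P = p^t this is a solution where p^t ∣ x and p^(t+1) ∣ f y.
isSol-factor-exact : ∀ {n f B0 C x y z} P q qx w → x ≡ qx * P → f * y ≡ w * (q * P) →
  IsSol n (f * f * B0) C (x , y , z) → C * z ^ n ≡ (qx * qx + q * (B0 * w * w * q)) * (P * P)
isSol-factor-exact {n} {f} {B0} {C} {x} {y} {z} P q qx w refl fy≡wqP sol = begin
  C * z ^ n                                      ≡⟨ sol ⟨
  x * x + f * f * B0 * (y * y)                   ≡⟨ regroup x f B0 y ⟩
  x * x + B0 * (f * y * (f * y))                 ≡⟨ cong (λ u → x * x + B0 * (u * u)) fy≡wqP ⟩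
  x * x + B0 * (w * (q * P) * (w * (q * P)))     ≡⟨ factor qx P B0 w q ⟩
  (qx * qx + q * (B0 * w * w * q)) * (P * P)     ∎
  where
  open ≡-Reasoning
  regroup : ∀ x f B0 y → x * x + f * f * B0 * (y * y) ≡ x * x + B0 * (f * y * (f * y))
  regroup = solve-∀
  factor : ∀ qx P B0 w q → qx * P * (qx * P) + B0 * (w * (q * P) * (w * (q * P)))
                           ≡ (qx * qx + q * (B0 * w * w * q)) * (P * P)
  factor = solve-∀

abs-factorisation : ∀ {C z S n} p t → C * z ^ n ≡ S * (+ (p ℕ.^ t) * + (p ℕ.^ t)) →
  ∣ C ∣ ℕ.* ∣ z ∣ ℕ.^ n ≡ ∣ S ∣ ℕ.* p ℕ.^ (2 ℕ.* t)
abs-factorisation {C} {z} {S} {n} p t eq = begin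
  ∣ C ∣ ℕ.* ∣ z ∣ ℕ.^ n      ≡⟨ abs-*^ C z n ⟨
  ∣ C * z ^ n ∣              ≡⟨ cong ∣_∣ eq ⟩
  ∣ S * (P * P) ∣            ≡⟨ ℤ.abs-* S (P * P) ⟩
  ∣ S ∣ ℕ.* ∣ P * P ∣        ≡⟨ cong (∣ S ∣ ℕ.*_) (trans (ℤ.abs-* P P) (m^n*m^n≡m^[2*n] p t)) ⟩
  ∣ S ∣ ℕ.* p ℕ.^ (2 ℕ.* t)  ∎
  where
  open ≡-Reasoning
  P : ℤ
  P = + (p ℕ.^ t)

module _ {p : ℕ} (p-prime : Prime p) where

  ∣c*z^n⇒∣z : ∀ {C} z n → ¬ (+ p ∣ C) → + p ∣ C * z ^ n → + p ∣ z
  ∣c*z^n⇒∣z {C} z n p∤C p∣Czⁿ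
    with euclidsLemma ∣ C ∣ (∣ z ∣ ℕ.^ n) p-prime (subst (p ℕDiv.∣_) (abs-*^ C z n) p∣Czⁿ)
  ... | inj₁ p∣C  = contradiction p∣C p∤C
  ... | inj₂ p∣zⁿ = prime∣^⇒∣ p-prime ∣ z ∣ n p∣zⁿ

  primitive-p∣x⇒p∤y : ∀ {n B C x y z} → ¬ (+ p ∣ C) → IsSol n B C (x , y , z) →
    Primitive (x , y , z) → + p ∣ x → ¬ (+ p ∣ y)
  primitive-p∣x⇒p∤y {n} {B} {C} {x} {y} {z} p∤C sol prim p∣x p∣y =
    prime≢1 p-prime (prim p p∣x p∣y p∣z)
    where
    p∣z : + p ∣ z
    p∣z = ∣c*z^n⇒∣z {C} z n p∤C (subst (λ i → + p ∣ i) sol (∣-sumOfSquares {+ p} {x} {y} B p∣x p∣y))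

  solution-p∣C⇒p∤y : ∀ {n f B0 C x y z} → + p ∣ C → IsSol n (f * f * B0) C (x , y , z) →
    p ∥[ 0 ] (x , f * y) → ¬ (+ p ∣ y)
  solution-p∣C⇒p∤y {n} {f} {B0} {C} {x} {y} {z} p∣C sol (_ , p∤x,fy) p∣y =
    p∤x,fy (p⇒p^1 {x} p∣x , p⇒p^1 {f * y} (∣n⇒∣m*n {+ p} {y} f p∣y))
    where
    p⇒p^1 : ∀ {i} → + p ∣ i → + (p ℕ.^ 1) ∣ i
    p⇒p^1 = subst (ℕDiv._∣ _) (sym (ℕ.*-identityʳ p))
    p∣x : + p ∣ x
    p∣x = ∣-square⇒∣ p-prime {x} (Signed.∣⇒∣ᵤ (Signed.∣m+n∣n⇒∣m {+ p} {x * x}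
      (subst (Signed._∣_ (+ p)) (sym sol) (Signed.∣m⇒∣m*n (z ^ n) (Signed.∣ᵤ⇒∣ {+ p} {C} p∣C)))
      (Signed.∣n⇒∣m*n (f * f * B0) (Signed.∣m⇒∣m*n y (Signed.∣ᵤ⇒∣ {+ p} {y} p∣y)))))

module _ {p : ℕ} (p-prime : Prime p) (2∤p : ¬ 2 ℕDiv.∣ p) where

  private instance
    p≢0 : ℕ.NonZero p
    p≢0 = prime⇒nonZero p-prime

  star-isEmpty-r<t : ∀ {n f B0 C r t} → ¬ (+ p ∣ C) → ¬ (p ℕ.^ suc r ℕDiv.∣ ∣ f ∣) → r < t →
    IsEmpty n (f * f * B0) C (Star B0 f p t)
  star-isEmpty-r<t {n} {f} {B0} {C} {r} {t} p∤C p^1+r∤f r<t ((x , y , z) , sol , prim , st) =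
    p^1+r∤f (coprime-divisor (Coprimality.sym (coprime-^ʳ (prime∤⇒coprime p-prime p∤y) (suc r)))
                             p^1+r∣yf)
    where
    p^t∣x,fy : p ℕ.^ t ∣² (x , f * y)
    p^t∣x,fy = proj₁ (to (star⇔∥ {B0} {f} {p} {t} {x} {y} {z} 2∤p) st)
    p∤y : ¬ (+ p ∣ y)
    p∤y = primitive-p∣x⇒p∤y p-prime {n} {f * f * B0} {C} {x} {y} {z} p∤C sol prim
      (ℕDiv.∣-trans (m∣m^n (ℕ.≤-trans (s≤s z≤n) r<t)) (proj₁ p^t∣x,fy))
    p^1+r∣yf : p ℕ.^ suc r ℕDiv.∣ ∣ y ∣ ℕ.* ∣ f ∣
    p^1+r∣yf = subst (_ ℕDiv.∣_) (trans (ℤ.abs-* f y) (ℕ.*-comm ∣ f ∣ ∣ y ∣))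
                 (ℕDiv.∣-trans (^-monoʳ-∣ p r<t) (proj₂ p^t∣x,fy))

  star-solution-n∣2t : ∀ {n f B0 C t x y z} → ¬ (+ p ∣ C) → p ℕ.^ suc t ℕDiv.∣ ∣ f ∣ →
    IsSol (suc n) (f * f * B0) C (x , y , z) → Star B0 f p t (x , y , z) → suc n ℕDiv.∣ 2 ℕ.* t
  star-solution-n∣2t {n} {f} {B0} {C} {t} {x} {y} {z} p∤C p^1+t∣f sol st =
    c*m^n≡s*p^e⇒n∣e p-prime {∣ C ∣} {∣ z ∣} {n} {∣ S ∣} {2 ℕ.* t} p∤C p∤S
      (abs-factorisation {C} {z} {S} {suc n} p t
        (isSol-factor-exact {suc n} {f} {B0} {C} {x} {y} {z} P (+ p) qx w x≡qxP fy≡wpP sol))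
    where
    P : ℤ
    P = + (p ℕ.^ t)
    exact : p ∥[ t ] (x , f * y)
    exact = to (star⇔∥ {B0} {f} {p} {t} {x} {y} {z} 2∤p) st
    p^1+t∣fy : + (p ℕ.^ suc t) ∣ f * y
    p^1+t∣fy = ∣m⇒∣m*n {+ (p ℕ.^ suc t)} {f} y p^1+t∣f
    p^1+t∤x : ¬ (+ (p ℕ.^ suc t) ∣ x)
    p^1+t∤x p^1+t∣x = proj₂ exact (p^1+t∣x , p^1+t∣fy)
    P∣x : P Signed.∣ x
    P∣x = Signed.∣ᵤ⇒∣ {P} {x} (proj₁ (proj₁ exact))
    pP∣fy : + (p ℕ.^ suc t) Signed.∣ f * y
    pP∣fy = Signed.∣ᵤ⇒∣ {+ (p ℕ.^ suc t)} {f * y} p^1+t∣fy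
    qx w : ℤ
    qx = Signed._∣_.quotient P∣x
    w = Signed._∣_.quotient pP∣fy
    x≡qxP : x ≡ qx * P
    x≡qxP = Signed._∣_.equality P∣x
    fy≡wpP : f * y ≡ w * (+ p * P)
    fy≡wpP = trans (Signed._∣_.equality pP∣fy) (cong (w *_) (ℤ.pos-* p (p ℕ.^ t)))
    S : ℤ
    S = qx * qx + + p * (B0 * w * w * + p)
    p∣qx⇒p^1+t∣x : + p ∣ qx → + (p ℕ.^ suc t) ∣ x
    p∣qx⇒p^1+t∣x p∣qx = subst (λ i → + (p ℕ.^ suc t) ∣ i) (sym x≡qxP)
      (to (∣-*ʳ⇔ {p} {p ℕ.^ t} {qx} {{ℕ.m^n≢0 p t}}) p∣qx)
    p∤S : ¬ (+ p ∣ S)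
    p∤S p∣S = p^1+t∤x (p∣qx⇒p^1+t∣x (∣-square⇒∣ p-prime {qx}
      (Signed.∣⇒∣ᵤ (Signed.∣m+n∣n⇒∣m {+ p} {qx * qx}
        (Signed.∣ᵤ⇒∣ {+ p} {S} p∣S) (Signed.∣m⇒∣m*n _ Signed.∣-refl)))))

  star-isEmpty-t<r : ∀ {n f B0 C r t} → ¬ 2 ℕDiv.∣ suc n → ¬ (+ p ∣ C) →
    p ℕ.^ r ℕDiv.∣ ∣ f ∣ → t < r → ¬ suc n ℕDiv.∣ t → IsEmpty (suc n) (f * f * B0) C (Star B0 f p t)
  star-isEmpty-t<r {n} {f} {B0} {C} {r} {t} 2∤n p∤C p^r∣f t<r n∤t ((x , y , z) , sol , _ , st) =
    n∤t (odd-∣-double 2∤n (star-solution-n∣2t {n} {f} {B0} {C} {t} {x} {y} {z} p∤C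
      (ℕDiv.∣-trans (^-monoʳ-∣ p t<r) p^r∣f) sol st))

  descaleEquiv : ∀ n {f f' B0 C C'} t k → 0 < t → f ≡ + (p ℕ.^ t) * f' → ¬ (+ p ∣ C) →
    C' * + (p ℕ.^ (2 ℕ.* t)) ≡ C * + (p ℕ.^ (k ℕ.* n)) → k ℕ.* n < n ℕ.+ 2 ℕ.* t →
    GEquiv n (f * f * B0) C (Star B0 f p t) n (f' * f' * B0) C' (StarCoprimeY B0 f' p)
  descaleEquiv n {f' = f'} {B0} {C} {C'} t k 0<t refl p∤C C'p^2t≡Cp^kn kn<n+2t =
    GEquiv-viaInjection (scale P Q) (scale-injective P Q) (scale-neg P Q) lift descend
    where
    open ≡-Reasoning
    P Q : ℤ
    P = + (p ℕ.^ t)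
    Q = + (p ℕ.^ k)
    instance
      P≢0 : NonZero P
      P≢0 = ℕ.m^n≢0 p t
      Q≢0 : NonZero Q
      Q≢0 = ℕ.m^n≢0 p k
    C'P²≡CQⁿ : C' * (P * P) ≡ C * Q ^ n
    C'P²≡CQⁿ = begin
      C' * (P * P)              ≡⟨ cong (C' *_) (trans (sym (ℤ.pos-* (p ℕ.^ t) (p ℕ.^ t)))
                                                       (cong +_ (m^n*m^n≡m^[2*n] p t))) ⟩
      C' * + (p ℕ.^ (2 ℕ.* t))  ≡⟨ C'p^2t≡Cp^kn ⟩
      C * + (p ℕ.^ (k ℕ.* n))   ≡⟨ cong (C *_) (trans (cong +_ (sym (ℕ.^-*-assoc p k n)))
                                                     (pos-^ (p ℕ.^ k) n)) ⟩
      C * Q ^ n                 ∎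
    isSol⇔ : ∀ x y z → IsSol n (P * f' * (P * f') * B0) C (x * P , y , z * Q)
                       ⇔ IsSol n (f' * f' * B0) C' (x , y , z)
    isSol⇔ x y z = isSol-rescale {n} {P * f'} {f'} {B0} {C} {C'} P Q {x} {y} {z} refl C'P²≡CQⁿ
    star⇔ : ∀ x y z → Star B0 (P * f') p t (x * P , y , z * Q) ⇔ Star B0 f' p 0 (x , y , z)
    star⇔ x y z = star-rescale {B0} {f'} {p} {t} {x} {y} {z * Q} {z} 2∤p
    lift : (b : Obj n (f' * f' * B0) C' (StarCoprimeY B0 f' p)) →
      IsObj n (P * f' * (P * f') * B0) C (Star B0 (P * f') p t) (scale P Q (proj₁ b))
    lift ((x , y , z) , sol , prim , st₀ , p∤y) =
      from (isSol⇔ x y z) sol ,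
      primitive-rescale {x} {y} {z} P Q (coprime-^ʳ y⊥p t) (coprime-^ʳ y⊥p k) prim ,
      from (star⇔ x y z) st₀
      where
      y⊥p : Coprime ∣ y ∣ p
      y⊥p = prime∤⇒coprime p-prime p∤y
    p^k∣z : ∀ x y z → IsSol n (P * f' * (P * f') * B0) C (x * P , y , z) → + (p ℕ.^ k) ∣ z
    p^k∣z x y z sol = c*m^n≡s*p^e⇒p^k∣m p-prime {∣ C ∣} {∣ z ∣} {n} {∣ S ∣} {2 ℕ.* t} k p∤C
      (abs-factorisation {C} {z} {S} {n} p t
        (isSol-factor {n} {P * f'} {f'} {B0} {C} P x y z refl sol))
      kn<n+2t
      where
      S : ℤ
      S = x * x + f' * f' * B0 * (y * y)
    descend : (a : Obj n (P * f' * (P * f') * B0) C (Star B0 (P * f') p t)) →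
      Σ (Obj n (f' * f' * B0) C' (StarCoprimeY B0 f' p)) λ b → scale P Q (proj₁ b) ≡ proj₁ a
    descend ((x , y , z) , sol , prim , st)
      with Signed.∣ᵤ⇒∣ {P} {x}
             (proj₁ (proj₁ (to (star⇔∥ {B0} {P * f'} {p} {t} {x} {y} {z} 2∤p) st)))
    ... | Signed.divides qx refl with Signed.∣ᵤ⇒∣ {Q} {z} (p^k∣z qx y z sol)
    ... | Signed.divides qz refl =
      ((qx , y , qz) ,
       to (isSol⇔ qx y qz) sol ,
       primitive-descale {qx} {y} {qz} P Q prim ,
       to (star⇔ qx y qz) st ,
       primitive-p∣x⇒p∤y p-prime {n} {P * f' * (P * f') * B0} {C} {qx * P} {y} {qz * Q} p∤C sol prim
         (ℕDiv.∣-trans (m∣m^n 0<t) (∣n⇒∣m*n {P} {P} qx ℕDiv.∣-refl))) ,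
      refl

  descaleEquiv-n∣t : ∀ n {f f' B0 C} t → 0 < n → 0 < t → n ℕDiv.∣ t → f ≡ + (p ℕ.^ t) * f' →
    ¬ (+ p ∣ C) → GEquiv n (f * f * B0) C (Star B0 f p t) n (f' * f' * B0) C (StarCoprimeY B0 f' p)
  descaleEquiv-n∣t n {C = C} t 0<n 0<t (ℕDiv.divides q t≡qn) f≡p^tf' p∤C =
    descaleEquiv n t (2 ℕ.* q) 0<t f≡p^tf' p∤C (cong (λ e → C * + (p ℕ.^ e)) 2t≡2qn)
      (subst (_< n ℕ.+ 2 ℕ.* t) 2t≡2qn (ℕ.m<n+m (2 ℕ.* t) 0<n))
    where
    2t≡2qn : 2 ℕ.* t ≡ 2 ℕ.* q ℕ.* n
    2t≡2qn = trans (cong (2 ℕ.*_) t≡qn) (sym (ℕ.*-assoc 2 q n))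

  descaleEquiv-t≡r : ∀ m {f f' B0 C} r t → t ≡ r → ¬ 2 ℕDiv.∣ suc m → ¬ suc m ℕDiv.∣ t → 0 < r →
    f ≡ + (p ℕ.^ r) * f' → ¬ (+ p ∣ C) →
    GEquiv (suc m) (f * f * B0) C (Star B0 f p t)
           (suc m) (f' * f' * B0) (C * + (p ℕ.^ (ceilDiv (2 ℕ.* r) (suc m) ℕ.* suc m ∸ 2 ℕ.* r)))
           (Star B0 f' p 0)
  descaleEquiv-t≡r m {f' = f'} {B0} {C} r .r refl 2∤n n∤r 0<r f≡p^rf' p∤C =
    GEquiv-congʳ (λ _ → proj₁) (λ {t} → star₀⇒p∤y {t})
      (descaleEquiv n r k 0<r f≡p^rf' p∤C Cp^r′p^2r≡Cp^kn (ceilDiv[m,n]*n<n+m (2 ℕ.* r) m))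
    where
    open ≡-Reasoning
    n k r′ : ℕ
    n = suc m
    k = ceilDiv (2 ℕ.* r) n
    r′ = k ℕ.* n ∸ 2 ℕ.* r
    2r≤kn : 2 ℕ.* r ≤ k ℕ.* n
    2r≤kn = m≤ceilDiv[m,n]*n (2 ℕ.* r) m
    Cp^r′p^2r≡Cp^kn : C * + (p ℕ.^ r′) * + (p ℕ.^ (2 ℕ.* r)) ≡ C * + (p ℕ.^ (k ℕ.* n))
    Cp^r′p^2r≡Cp^kn = begin
      C * + (p ℕ.^ r′) * + (p ℕ.^ (2 ℕ.* r))
        ≡⟨ ℤ.*-assoc C _ _ ⟩
      C * (+ (p ℕ.^ r′) * + (p ℕ.^ (2 ℕ.* r)))
        ≡⟨ cong (C *_) (ℤ.pos-* (p ℕ.^ r′) (p ℕ.^ (2 ℕ.* r))) ⟨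
      C * + (p ℕ.^ r′ ℕ.* p ℕ.^ (2 ℕ.* r))
        ≡⟨ cong (λ e → C * + e) (ℕ.^-distribˡ-+-* p r′ (2 ℕ.* r)) ⟨
      C * + (p ℕ.^ (r′ ℕ.+ 2 ℕ.* r))
        ≡⟨ cong (λ e → C * + (p ℕ.^ e)) (ℕ.m∸n+n≡m 2r≤kn) ⟩
      C * + (p ℕ.^ (k ℕ.* n))
        ∎
    0<r′ : 0 < r′
    0<r′ = ℕ.n≢0⇒n>0 λ r′≡0 →
      n∤r (odd-∣-double 2∤n (ℕDiv.divides k (ℕ.≤-antisym 2r≤kn (ℕ.m∸n≡0⇒m≤n r′≡0))))
    p∣C′ : + p ∣ C * + (p ℕ.^ r′)
    p∣C′ = ∣n⇒∣m*n {+ p} {+ (p ℕ.^ r′)} C (m∣m^n 0<r′)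
    star₀⇒p∤y : ∀ {t} → IsSol n (f' * f' * B0) (C * + (p ℕ.^ r′)) t →
      Star B0 f' p 0 t → StarCoprimeY B0 f' p t
    star₀⇒p∤y {x , y , z} sol st₀ =
      st₀ , solution-p∣C⇒p∤y p-prime {n} {f'} {B0} {C * + (p ℕ.^ r′)} {x} {y} {z} p∣C′ sol
              (to (star⇔∥ {B0} {f'} {p} {0} {x} {y} {z} 2∤p) st₀)

lemma6p2 : (n : ℕ) → 3 ≤ n → ¬ (2 ℕDiv.∣ n) →
    (f B0 C : ℤ) → f ≢ + 0 → B0 ≢ + 0 → C ≢ + 0 →
    B0 ≢ - (+ 1) → Squarefree B0 → Coprime ∣ f ∣ ∣ C ∣ →
    (p : ℕ) → Prime p → p ≢ 2 →
    (r : ℕ) → 0 < r → (p ℕ.^ r) ℕDiv.∣ ∣ f ∣ → ¬ ((p ℕ.^ suc r) ℕDiv.∣ ∣ f ∣) →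
    (t : ℕ) → 0 < t →
      (r < t → IsEmpty n (f * f * B0) C (Star B0 f p t))
    × (t < r → ¬ (n ℕDiv.∣ t) → IsEmpty n (f * f * B0) C (Star B0 f p t))
    × (t ≤ r → n ℕDiv.∣ t → (f' : ℤ) → f ≡ + (p ℕ.^ t) * f' →
         GEquiv n (f * f * B0) C (Star B0 f p t)
                n (f' * f' * B0) C
                  (λ { (x , y , z) → Star B0 f' p 0 (x , y , z)
                                     × ¬ (p ℕDiv.∣ ∣ y ∣) }))
    × (t ≡ r → ¬ (n ℕDiv.∣ t) → (f' : ℤ) → f ≡ + (p ℕ.^ r) * f' →
         GEquiv n (f * f * B0) C (Star B0 f p t)
                n (f' * f' * B0)
                  (C * + (p ℕ.^ (ceilDiv (2 ℕ.* r) n ℕ.* n ∸ 2 ℕ.* r)))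
                  (Star B0 f' p 0))
lemma6p2 (suc m) (s≤s _) 2∤n f B0 C _ _ _ _ _ f⊥C p p-prime p≢2 r 0<r p^r∣f p^1+r∤f t 0<t =
    (λ r<t → star-isEmpty-r<t p-prime 2∤p {suc m} {f} {B0} {C} p∤C p^1+r∤f r<t)
  , (λ t<r n∤t → star-isEmpty-t<r p-prime 2∤p {m} {f} {B0} {C} 2∤n p∤C p^r∣f t<r n∤t)
  , (λ _ n∣t f' f≡p^tf' → descaleEquiv-n∣t p-prime 2∤p (suc m) t (s≤s z≤n) 0<t n∣t f≡p^tf' p∤C)
  , (λ t≡r n∤t f' f≡p^rf' → descaleEquiv-t≡r p-prime 2∤p m r t t≡r 2∤n n∤t 0<r f≡p^rf' p∤C)
  where
  2∤p : ¬ 2 ℕDiv.∣ p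
  2∤p = prime≢2⇒odd p-prime p≢2
  p∤C : ¬ (+ p ∣ C)
  p∤C p∣C = prime≢1 p-prime (f⊥C (ℕDiv.∣-trans (m∣m^n 0<r) p^r∣f , p∣C))
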